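{- Let $m,n\ge 2$ and let $A=[a_{ij}]$ be a $12$-avoiding $m\times n$ $(0,1)$-matrix having the maximum possible number $m+n-1$ of $1$'s. Then $A$ is obtained from the trivial $m\times n$ $12$-avoiding matrix by translating a Ferrers array of its $0$'s one unit in the northwest direction; in particular the $1$'s of $A$ form a complete R-L zigzag path.
   Context: An $m\times n$ $(0,1)$-matrix $A=[a_{ij}]$ is $12$-avoiding if there are no $i<i'$ and $j<j'$ with $a_{ij}=a_{i'j'}=1$ (equivalently, no $2\times 2$ submatrix with $1$'s on its main diagonal). The trivial $m\times n$ $12$-avoiding matrix is the matrix whose first row and first column consist entirely of $1$'s and all of whose other entries are $0$; it has an $(m-1)\times(n-1)$ zero submatrix in its lower right corner. That zero submatrix is partitioned into a Ferrers array (a set of positions closed under moving up or left within the submatrix, i.e. left-justified rows of weakly decreasing lengths from top to bottom) and its complement (a reverse Ferrers array); the Ferrers array is then shifted one position up and one position left (along the diagonals), the shifted positions become the $0$'s and all remaining positions become $1$'s. An $m\times n$ $(0,1)$-matrix has a complete R-L zigzag path if (i) it has exactly $m+n-1$ $1$'s, (ii) $a_{1n}=a_{m1}=1$, and (iii) every $1$ of $A$ other than $a_{m1}$ has a $1$ immediately to its left or immediately below it, but not both. -}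

module Defs where

open import Data.Nat using (ℕ; zero; suc; _+_; _∸_; _≤_; _<_)
open import Data.Fin using (Fin; toℕ)
open import Data.Bool using (Bool; true; false)
open import Data.List using (List; map; allFin)
open import Data.Nat.ListAction using (sum)
open import Data.Product using (Σ; _×_; ∃; ∃-syntax)
open import Data.Sum using (_⊎_)
open import Data.Empty using (⊥)
open import Relation.Nullary using (¬_)
open import Relation.Binary.PropositionalEquality using (_≡_)
open import Function.Bundles using (_⇔_)

-- An m × n (0,1)-matrix; rows and columns are 0-indexed,
-- entry (i , j) is "1" iff it is true.
Matrix : ℕ → ℕ → Set
Matrix m n = Fin m → Fin n → Bool

bit : Bool → ℕ
bit true  = 1
bit false = 0

numOnes : ∀ {m n} → Matrix m n → ℕ
numOnes {m} {n} A = sum (map (λ i → sum (map (λ j → bit (A i j)) (allFin n))) (allFin m))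

Avoid12 : ∀ {m n} → Matrix m n → Set
Avoid12 {m} {n} A =
  (i i' : Fin m) (j j' : Fin n) → toℕ i < toℕ i' → toℕ j < toℕ j' →
  A i j ≡ true → A i' j' ≡ true → ⊥

IsFerrers : ∀ {m n} → (Fin m → Fin n → Bool) → Set
IsFerrers {m} {n} F =
  ((i : Fin m) (j : Fin n) → F i j ≡ true → (1 ≤ toℕ i) × (1 ≤ toℕ j)) ×
  ((i i' : Fin m) (j j' : Fin n) →
     1 ≤ toℕ i' → toℕ i' ≤ toℕ i → 1 ≤ toℕ j' → toℕ j' ≤ toℕ j →
     F i j ≡ true → F i' j' ≡ true)

InShifted : ∀ {m n} → (Fin m → Fin n → Bool) → Fin m → Fin n → Set
InShifted {m} {n} F i j =
  Σ (Fin m) λ i' → Σ (Fin n) λ j' →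
    (toℕ i' ≡ suc (toℕ i)) × (toℕ j' ≡ suc (toℕ j)) × (F i' j' ≡ true)

-- A is obtained from the trivial m × n 12-avoiding matrix by translating the
-- Ferrers array F of its 0's one unit northwest: the 0's of A are exactly the
-- translated positions of F together with the positions of the zero
-- submatrix not in F (the reverse Ferrers complement, which stays in place);
-- every other position is a 1.
ShiftOf : ∀ {m n} → (Fin m → Fin n → Bool) → Matrix m n → Set
ShiftOf {m} {n} F A =
  (i : Fin m) (j : Fin n) →
    (A i j ≡ false) ⇔
    (InShifted F i j ⊎ ((1 ≤ toℕ i) × (1 ≤ toℕ j) × (F i j ≡ false)))

OneLeft : ∀ {m n} → Matrix m n → Fin m → Fin n → Set
OneLeft {m} {n} A i j = Σ (Fin n) λ j' → (suc (toℕ j') ≡ toℕ j) × (A i j' ≡ true)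

OneBelow : ∀ {m n} → Matrix m n → Fin m → Fin n → Set
OneBelow {m} {n} A i j = Σ (Fin m) λ i' → (toℕ i' ≡ suc (toℕ i)) × (A i' j ≡ true)

CompleteZigzag : ∀ {m n} → Matrix m n → Set
CompleteZigzag {m} {n} A =
  (numOnes A ≡ m + n ∸ 1) ×
  ((i : Fin m) (j : Fin n) → toℕ i ≡ 0 → toℕ j ≡ n ∸ 1 → A i j ≡ true) ×
  ((i : Fin m) (j : Fin n) → toℕ i ≡ m ∸ 1 → toℕ j ≡ 0 → A i j ≡ true) ×
  ((i : Fin m) (j : Fin n) → A i j ≡ true → ¬ ((toℕ i ≡ m ∸ 1) × (toℕ j ≡ 0)) →
     (OneLeft A i j ⊎ OneBelow A i j) × ¬ (OneLeft A i j × OneBelow A i j))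

module Submission where

-- Peel off the rows of a 12-avoiding matrix from the top.  If
-- all 1's of A lie in columns ≤ c and row 0 has its leftmost 1 in column c',
-- then row 0 has at most c + 1 - c' ones, and by 12-avoidance every lower
-- row has its 1's in columns ≤ c'.  Inductively an m-row matrix whose 1's
-- lie in columns ≤ c has at most m + c ones (countBound), and equality
-- forces a "staircase": a weakly decreasing sequence c = x 0 ≥ x 1 ≥ … ≥
-- x m = 0 such that the 1's of row i are exactly the columns x (i+1) … x i.
-- With c = n - 1 this covers every 12-avoiding matrix with m + n - 1 ones.
-- From the staircase both conclusions are read off (module FromStaircase):
-- the Ferrers array is F = {(i , j) : i , j ≥ 1, j ≤ x i}; a 0 lies either
-- strictly left of its row's interval (the shifted copy of F) or strictly
-- right of it (the part of the zero block outside F); and along the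
-- staircase every 1 has exactly one neighbour to its left or below it.

open import Defs
open import Data.Nat using (ℕ; zero; suc; _+_; _∸_; _≤_; _<_; z≤n; s≤s; s≤s⁻¹; _≤?_; _<?_)
open import Data.Nat.Properties
open import Data.Nat.ListAction using (sum)
open import Data.Fin using (Fin; toℕ; fromℕ<; inject₁) renaming (zero to fzero; suc to fsuc)
open import Data.Fin.Properties using (toℕ<n; toℕ-fromℕ<; toℕ-inject₁)
open import Data.Bool using (Bool; true; false)
open import Data.Bool.Properties using (¬-not)
open import Data.List using (map; allFin)
open import Data.List.Properties using (map-tabulate)
open import Data.Product using (Σ; ∃; _×_; _,_; proj₁; proj₂; uncurry)
open import Data.Sum using (_⊎_; inj₁; inj₂)
open import Data.Sum.Function.Propositional using (_⊎-⇔_)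
open import Data.Empty using (⊥-elim)
open import Function using (_∘_; id)
open import Function.Bundles using (_⇔_; mk⇔)
open import Function.Properties.Equivalence using () renaming (trans to ⇔-trans)
open import Relation.Nullary using (¬_; Dec; yes; no; does; contradiction)
open import Relation.Nullary.Decidable using (_×-dec_; dec-true)
open import Relation.Binary.PropositionalEquality
  using (_≡_; _≢_; refl; sym; trans; cong; cong₂; subst; subst₂; module ≡-Reasoning)

bit≡1 : ∀ {b} → bit b ≡ 1 → b ≡ true
bit≡1 {true}  _ = refl
bit≡1 {false} ()

does-true : ∀ {P : Set} (p? : Dec P) → does p? ≡ true → P
does-true (yes p) _ = p
does-true (no _)  ()

finOf : ∀ {k} t → t < k → Σ (Fin k) λ i → toℕ i ≡ t
finOf t t<k = fromℕ< t<k , toℕ-fromℕ< t<k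

finSum : ∀ n → (Fin n → ℕ) → ℕ
finSum n f = sum (map f (allFin n))

finSum-suc : ∀ n (f : Fin (suc n) → ℕ) → finSum (suc n) f ≡ f fzero + finSum n (f ∘ fsuc)
finSum-suc n f =
  cong (λ xs → f fzero + sum xs) (trans (map-tabulate fsuc f) (sym (map-tabulate id (f ∘ fsuc))))

finSum-zero : ∀ n {f : Fin n → ℕ} → (∀ j → f j ≡ 0) → finSum n f ≡ 0
finSum-zero zero    _    = refl
finSum-zero (suc n) {f} f≡0 = begin
  finSum (suc n) f               ≡⟨ finSum-suc n f ⟩
  f fzero + finSum n (f ∘ fsuc)  ≡⟨ cong₂ _+_ (f≡0 fzero) (finSum-zero n (f≡0 ∘ fsuc)) ⟩
  0                              ∎
  where open ≡-Reasoning

finSum-mono : ∀ n {f g : Fin n → ℕ} → (∀ j → f j ≤ g j) → finSum n f ≤ finSum n g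
finSum-mono zero    _ = z≤n
finSum-mono (suc n) {f} {g} f≤g = begin
  finSum (suc n) f               ≡⟨ finSum-suc n f ⟩
  f fzero + finSum n (f ∘ fsuc)  ≤⟨ +-mono-≤ (f≤g fzero) (finSum-mono n (f≤g ∘ fsuc)) ⟩
  g fzero + finSum n (g ∘ fsuc)  ≡⟨ sym (finSum-suc n g) ⟩
  finSum (suc n) g               ∎
  where open ≤-Reasoning

+-tight : ∀ {a b p q} → a ≤ p → b ≤ q → a + b ≡ p + q → a ≡ p × b ≡ q
+-tight {a} {b} {p} {q} a≤p b≤q a+b≡p+q = a≡p , +-cancelˡ-≡ a b q (trans a+b≡p+q (cong (_+ q) (sym a≡p)))
  where
  p≤a : p ≤ a
  p≤a = +-cancelʳ-≤ q p a (subst (_≤ a + q) a+b≡p+q (+-monoʳ-≤ a b≤q))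
  a≡p : a ≡ p
  a≡p = ≤-antisym a≤p p≤a

finSum-tight : ∀ n {f g : Fin n → ℕ} → (∀ j → f j ≤ g j) → finSum n f ≡ finSum n g →
  ∀ j → f j ≡ g j
finSum-tight (suc n) {f} {g} f≤g sums≡ j = pointwise j
  where
  split : f fzero ≡ g fzero × finSum n (f ∘ fsuc) ≡ finSum n (g ∘ fsuc)
  split = +-tight (f≤g fzero) (finSum-mono n (f≤g ∘ fsuc))
    (trans (sym (finSum-suc n f)) (trans sums≡ (finSum-suc n g)))
  pointwise : ∀ j → f j ≡ g j
  pointwise fzero    = proj₁ split
  pointwise (fsuc j) = finSum-tight n (f≤g ∘ fsuc) (proj₂ split) j

-- The indicator of lo ≤ k ≤ hi, by recursion so that it commutes with
-- shifting all three arguments by one.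
interval : ℕ → ℕ → ℕ → ℕ
interval zero     hi       zero    = 1
interval zero     zero     (suc k) = 0
interval zero     (suc hi) (suc k) = interval zero hi k
interval (suc lo) hi       zero    = 0
interval (suc lo) zero     (suc k) = 0
interval (suc lo) (suc hi) (suc k) = interval lo hi k

interval-inside : ∀ lo hi k → lo ≤ k → k ≤ hi → interval lo hi k ≡ 1
interval-inside zero     hi       zero    z≤n     _       = refl
interval-inside zero     (suc hi) (suc k) z≤n     (s≤s q) = interval-inside zero hi k z≤n q
interval-inside (suc lo) (suc hi) (suc k) (s≤s p) (s≤s q) = interval-inside lo hi k p q

interval-count : ∀ n {lo hi} → lo ≤ hi → hi < n → finSum n (interval lo hi ∘ toℕ) ≡ suc hi ∸ lo
interval-count (suc n) {zero} {zero} _ _ =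
  trans (finSum-suc n (interval 0 0 ∘ toℕ)) (cong suc (finSum-zero n (λ _ → refl)))
interval-count (suc n) {zero} {suc hi} _ (s≤s hi<n) =
  trans (finSum-suc n (interval 0 (suc hi) ∘ toℕ)) (cong suc (interval-count n z≤n hi<n))
interval-count (suc n) {suc lo} {suc hi} (s≤s lo≤hi) (s≤s hi<n) =
  trans (finSum-suc n (interval (suc lo) (suc hi) ∘ toℕ)) (interval-count n lo≤hi hi<n)

intervalRow : ∀ {n} (r : Fin n → Bool) {lo hi} → lo ≤ hi → hi < n →
  (∀ j → r j ≡ true → lo ≤ toℕ j × toℕ j ≤ hi) →
  finSum n (bit ∘ r) ≤ suc hi ∸ lo ×
  (finSum n (bit ∘ r) ≡ suc hi ∸ lo → ∀ j → lo ≤ toℕ j → toℕ j ≤ hi → r j ≡ true)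
intervalRow {n} r {lo} {hi} lo≤hi hi<n inside = bound , full
  where
  below : ∀ j → bit (r j) ≤ interval lo hi (toℕ j)
  below j with r j in rj
  ... | true  = ≤-reflexive (sym (uncurry (interval-inside lo hi (toℕ j)) (inside j rj)))
  ... | false = z≤n
  bound : finSum n (bit ∘ r) ≤ suc hi ∸ lo
  bound = subst (finSum n (bit ∘ r) ≤_) (interval-count n lo≤hi hi<n) (finSum-mono n below)
  full : finSum n (bit ∘ r) ≡ suc hi ∸ lo → ∀ j → lo ≤ toℕ j → toℕ j ≤ hi → r j ≡ true
  full count≡ j p q = bit≡1 (trans
    (finSum-tight n below (trans count≡ (sym (interval-count n lo≤hi hi<n))) j)
    (interval-inside lo hi (toℕ j) p q))

rowCount : ∀ {m n} → Matrix m n → Fin m → ℕ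
rowCount {n = n} A i = finSum n (bit ∘ A i)

dropTop : ∀ {m n} → Matrix (suc m) n → Matrix m n
dropTop A i = A (fsuc i)

numOnes-dropTop : ∀ {m n} (A : Matrix (suc m) n) →
  numOnes A ≡ rowCount A fzero + numOnes (dropTop A)
numOnes-dropTop {m} A = finSum-suc m (rowCount A)

dropTop-avoids : ∀ {m n} {A : Matrix (suc m) n} → Avoid12 A → Avoid12 (dropTop A)
dropTop-avoids avoids i i' j j' i<i' = avoids (fsuc i) (fsuc i') j j' (s≤s i<i')

OnesWithin : ∀ {m n} → Matrix m n → ℕ → Set
OnesWithin A c = ∀ i j → A i j ≡ true → toℕ j ≤ c

LeftmostOne : ∀ {n} → (Fin n → Bool) → Fin n → Set
LeftmostOne r j = r j ≡ true × (∀ j' → toℕ j' < toℕ j → r j' ≡ false)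

emptyOrLeftmost : ∀ {n} (r : Fin n → Bool) → (∀ j → r j ≡ false) ⊎ ∃ (LeftmostOne r)
emptyOrLeftmost {zero} r = inj₁ λ ()
emptyOrLeftmost {suc n} r with r fzero in r0
... | true  = inj₂ (fzero , r0 , λ _ ())
... | false with emptyOrLeftmost (r ∘ fsuc)
...   | inj₁ empty = inj₁ λ { fzero → r0 ; (fsuc j) → empty j }
...   | inj₂ (j , rj , left) =
  inj₂ (fsuc j , rj , λ { fzero _ → r0 ; (fsuc j') (s≤s j'<j) → left j' j'<j })

leftmost-≤ : ∀ {n} {r : Fin n → Bool} {j₀ j} → LeftmostOne r j₀ → r j ≡ true → toℕ j₀ ≤ toℕ j
leftmost-≤ {j = j} (_ , left) rj = ≮⇒≥ λ j<j₀ → contradiction (trans (sym rj) (left j j<j₀)) λ ()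

belowTopOne : ∀ {m n} {A : Matrix (suc m) n} {j₀} → Avoid12 A → A fzero j₀ ≡ true →
  OnesWithin (dropTop A) (toℕ j₀)
belowTopOne {j₀ = j₀} avoids top i j a = ≮⇒≥ λ j₀<j → avoids fzero (fsuc i) j₀ j (s≤s z≤n) j₀<j top a

record Staircase {m n} (A : Matrix m n) (c : ℕ) : Set where
  field
    x           : ℕ → ℕ
    x-top       : x 0 ≡ c
    x-bottom    : x m ≡ 0
    x-step      : ∀ k → x (suc k) ≤ x k
    one⇒between : ∀ i j → A i j ≡ true → x (suc (toℕ i)) ≤ toℕ j × toℕ j ≤ x (toℕ i)
    between⇒one : ∀ i j → x (suc (toℕ i)) ≤ toℕ j → toℕ j ≤ x (toℕ i) → A i j ≡ true

staircase-cons : ∀ {m n} {A : Matrix (suc m) n} {c c'} → c' ≤ c →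
  (∀ j → A fzero j ≡ true → c' ≤ toℕ j × toℕ j ≤ c) →
  (∀ j → c' ≤ toℕ j → toℕ j ≤ c → A fzero j ≡ true) →
  Staircase (dropTop A) c' → Staircase A c
staircase-cons {A = A} {c} {c'} c'≤c topInside topFull rest = record
  { x = x ; x-top = refl ; x-bottom = R.x-bottom ; x-step = step
  ; one⇒between = one⇒between ; between⇒one = between⇒one }
  where
  module R = Staircase rest
  x : ℕ → ℕ
  x zero    = c
  x (suc k) = R.x k
  step : ∀ k → x (suc k) ≤ x k
  step zero    = subst (_≤ c) (sym R.x-top) c'≤c
  step (suc k) = R.x-step k
  one⇒between : ∀ i j → A i j ≡ true → x (suc (toℕ i)) ≤ toℕ j × toℕ j ≤ x (toℕ i)
  one⇒between fzero    j a = subst (_≤ toℕ j) (sym R.x-top) (proj₁ (topInside j a)) , proj₂ (topInside j a)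
  one⇒between (fsuc i) j a = R.one⇒between i j a
  between⇒one : ∀ i j → x (suc (toℕ i)) ≤ toℕ j → toℕ j ≤ x (toℕ i) → A i j ≡ true
  between⇒one fzero    j p q = topFull j (subst (_≤ toℕ j) R.x-top p) q
  between⇒one (fsuc i) j p q = R.between⇒one i j p q

CountBound : ∀ {m n} → Matrix m n → ℕ → Set
CountBound {m} A c = numOnes A ≤ m + c × (numOnes A ≡ m + c → Staircase A c)

-- An empty top row loses one from the bound, so equality is impossible.
countBound-emptyTop : ∀ {m n} {A : Matrix (suc m) n} {c} → (∀ j → A fzero j ≡ false) →
  CountBound (dropTop A) c → CountBound A c
countBound-emptyTop {m} {n} {A} {c} empty (rest≤ , _) =
  m≤n⇒m≤1+n count≤ , λ count≡ → ⊥-elim (1+n≰n (subst (_≤ m + c) count≡ count≤))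
  where
  count≤ : numOnes A ≤ m + c
  count≤ = subst (_≤ m + c)
    (sym (trans (numOnes-dropTop A) (cong (_+ numOnes (dropTop A)) (finSum-zero n (cong bit ∘ empty)))))
    rest≤

countBound-top : ∀ {m n} {A : Matrix (suc m) n} {c c'} → c < n → c' ≤ c →
  (∀ j → A fzero j ≡ true → c' ≤ toℕ j × toℕ j ≤ c) →
  CountBound (dropTop A) c' → CountBound A c
countBound-top {m} {n} {A} {c} {c'} c<n c'≤c topInside (rest≤ , restStaircase) = bound , staircase
  where
  top = intervalRow (A fzero) c'≤c c<n topInside
  total : (suc c ∸ c') + (m + c') ≡ suc m + c
  total = begin
    (suc c ∸ c') + (m + c')  ≡⟨ cong ((suc c ∸ c') +_) (+-comm m c') ⟩
    (suc c ∸ c') + (c' + m)  ≡⟨ sym (+-assoc (suc c ∸ c') c' m) ⟩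
    (suc c ∸ c') + c' + m    ≡⟨ cong (_+ m) (m∸n+n≡m (m≤n⇒m≤1+n c'≤c)) ⟩
    suc c + m                ≡⟨ cong suc (+-comm c m) ⟩
    suc m + c                ∎
    where open ≡-Reasoning
  bound : numOnes A ≤ suc m + c
  bound = begin
    numOnes A                                   ≡⟨ numOnes-dropTop A ⟩
    rowCount A fzero + numOnes (dropTop A)      ≤⟨ +-mono-≤ (proj₁ top) rest≤ ⟩
    (suc c ∸ c') + (m + c')                     ≡⟨ total ⟩
    suc m + c                                   ∎
    where open ≤-Reasoning
  staircase : numOnes A ≡ suc m + c → Staircase A c
  staircase count≡ =
    staircase-cons c'≤c topInside (proj₂ top (proj₁ parts)) (restStaircase (proj₂ parts))
    where
    parts = +-tight (proj₁ top) rest≤ (trans (sym (numOnes-dropTop A)) (trans count≡ (sym total)))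

countBound : ∀ m {n} (A : Matrix m n) → Avoid12 A → ∀ c → c < n → OnesWithin A c → CountBound A c
countBound zero A _ c _ _ = z≤n , λ c≡0 → record
  { x = λ _ → 0 ; x-top = c≡0 ; x-bottom = refl ; x-step = λ _ → z≤n
  ; one⇒between = λ () ; between⇒one = λ () }
countBound (suc m) A avoids c c<n within with emptyOrLeftmost (A fzero)
... | inj₁ empty = countBound-emptyTop empty
  (countBound m (dropTop A) (dropTop-avoids avoids) c c<n (within ∘ fsuc))
... | inj₂ (j₀ , leftmost) = countBound-top c<n (within fzero j₀ (proj₁ leftmost))
  (λ j a → leftmost-≤ leftmost a , within fzero j a)
  (countBound m (dropTop A) (dropTop-avoids avoids) (toℕ j₀) (toℕ<n j₀) (belowTopOne avoids (proj₁ leftmost)))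

module FromStaircase {m n : ℕ} (A : Matrix (suc m) (suc n)) (st : Staircase A n) where
  open Staircase st

  x-antitone : ∀ {k l} → k ≤ l → x l ≤ x k
  x-antitone {l = zero} z≤n = ≤-refl
  x-antitone {l = suc l} k≤1+l with m≤n⇒m<n∨m≡n k≤1+l
  ... | inj₁ (s≤s k≤l) = ≤-trans (x-step l) (x-antitone k≤l)
  ... | inj₂ refl      = ≤-refl

  x-≤ : ∀ k → x k ≤ n
  x-≤ k = subst (x k ≤_) x-top (x-antitone z≤n)

  lastRow : (i : Fin (suc m)) → toℕ i ≡ m → x (suc (toℕ i)) ≡ 0
  lastRow i i≡m = trans (cong (x ∘ suc) i≡m) x-bottom

  nextRow : (i : Fin (suc m)) → toℕ i ≢ m → Σ (Fin (suc m)) λ i' → toℕ i' ≡ suc (toℕ i)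
  nextRow i i≢m = finOf (suc (toℕ i)) (s≤s (≤∧≢⇒< (s≤s⁻¹ (toℕ<n i)) i≢m))

  InFerrers : ℕ → ℕ → Set
  InFerrers i j = 1 ≤ i × 1 ≤ j × j ≤ x i

  inFerrers? : ∀ i j → Dec (InFerrers i j)
  inFerrers? i j = (1 ≤? i) ×-dec ((1 ≤? j) ×-dec (j ≤? x i))

  F : Matrix (suc m) (suc n)
  F i j = does (inFerrers? (toℕ i) (toℕ j))

  F-true : ∀ i j → F i j ≡ true → InFerrers (toℕ i) (toℕ j)
  F-true i j = does-true (inFerrers? (toℕ i) (toℕ j))

  F-intro : ∀ i j → InFerrers (toℕ i) (toℕ j) → F i j ≡ true
  F-intro i j = dec-true (inFerrers? (toℕ i) (toℕ j))

  -- F is closed under moving up or left because x decreases down the rows.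
  ferrers : IsFerrers F
  ferrers = (λ i j Fij → proj₁ (F-true i j Fij) , proj₁ (proj₂ (F-true i j Fij))) ,
    λ i i' j j' 1≤i' i'≤i 1≤j' j'≤j Fij →
      F-intro i' j' (1≤i' , 1≤j' , ≤-trans j'≤j (≤-trans (proj₂ (proj₂ (F-true i j Fij))) (x-antitone i'≤i)))

  zero⇔outside : ∀ i j → (A i j ≡ false) ⇔ (toℕ j < x (suc (toℕ i)) ⊎ x (toℕ i) < toℕ j)
  zero⇔outside i j = mk⇔ outside inside
    where
    outside : A i j ≡ false → toℕ j < x (suc (toℕ i)) ⊎ x (toℕ i) < toℕ j
    outside a with toℕ j <? x (suc (toℕ i)) | x (toℕ i) <? toℕ j
    ... | yes left | _         = inj₁ left
    ... | no _     | yes right = inj₂ right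
    ... | no ¬left | no ¬right =
      contradiction (trans (sym a) (between⇒one i j (≮⇒≥ ¬left) (≮⇒≥ ¬right))) λ ()
    inside : toℕ j < x (suc (toℕ i)) ⊎ x (toℕ i) < toℕ j → A i j ≡ false
    inside (inj₁ left)  = ¬-not λ a → <⇒≱ left (proj₁ (one⇒between i j a))
    inside (inj₂ right) = ¬-not λ a → <⇒≱ right (proj₂ (one⇒between i j a))

  left⇔shifted : ∀ i j → (toℕ j < x (suc (toℕ i))) ⇔ InShifted F i j
  left⇔shifted i j = mk⇔ shifted left
    where
    shifted : toℕ j < x (suc (toℕ i)) → InShifted F i j
    shifted j<x = i' , j' , i'≡ , j'≡ , F-intro i' j' (subst₂ InFerrers (sym i'≡) (sym j'≡) (s≤s z≤n , s≤s z≤n , j<x))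
      where
      notLast : toℕ i ≢ m
      notLast i≡m = n≮0 (subst (toℕ j <_) (lastRow i i≡m) j<x)
      i' = proj₁ (nextRow i notLast)
      i'≡ = proj₂ (nextRow i notLast)
      j' = proj₁ (finOf {suc n} (suc (toℕ j)) (s≤s (≤-trans j<x (x-≤ _))))
      j'≡ = proj₂ (finOf {suc n} (suc (toℕ j)) (s≤s (≤-trans j<x (x-≤ _))))
    left : InShifted F i j → toℕ j < x (suc (toℕ i))
    left (i' , j' , i'≡ , j'≡ , Fi'j') = subst₂ (λ a b → b ≤ x a) i'≡ j'≡ (proj₂ (proj₂ (F-true i' j' Fi'j')))

  right⇔outsideF : ∀ i j → (x (toℕ i) < toℕ j) ⇔ (1 ≤ toℕ i × 1 ≤ toℕ j × F i j ≡ false)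
  right⇔outsideF i j = mk⇔ outsideF right
    where
    notTopRow : ∀ i → x (toℕ i) < toℕ j → 1 ≤ toℕ i
    notTopRow fzero    x<j = contradiction (subst (toℕ j ≤_) (sym x-top) (s≤s⁻¹ (toℕ<n j))) (<⇒≱ x<j)
    notTopRow (fsuc _) _   = s≤s z≤n
    outsideF : x (toℕ i) < toℕ j → 1 ≤ toℕ i × 1 ≤ toℕ j × F i j ≡ false
    outsideF x<j = notTopRow i x<j , ≤-trans (s≤s z≤n) x<j ,
      ¬-not λ Fij → <⇒≱ x<j (proj₂ (proj₂ (F-true i j Fij)))
    right : 1 ≤ toℕ i × 1 ≤ toℕ j × F i j ≡ false → x (toℕ i) < toℕ j
    right (1≤i , 1≤j , ¬Fij) = ≰⇒> λ j≤x → contradiction (trans (sym ¬Fij) (F-intro i j (1≤i , 1≤j , j≤x))) λ ()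

  shift : ShiftOf F A
  shift i j = ⇔-trans (zero⇔outside i j) (left⇔shifted i j ⊎-⇔ right⇔outsideF i j)

  -- Zigzag: a 1 right of its row's start has its left neighbour; the start of
  -- a row (except the last) has the neighbour below; never both.
  leftNeighbour : ∀ i j → x (suc (toℕ i)) < toℕ j → toℕ j ≤ x (toℕ i) → OneLeft A i j
  leftNeighbour i (fsuc j₀) x<j j≤x = inject₁ j₀ , cong suc (toℕ-inject₁ j₀) ,
    between⇒one i (inject₁ j₀)
      (subst (x (suc (toℕ i)) ≤_) (sym (toℕ-inject₁ j₀)) (s≤s⁻¹ x<j))
      (subst (_≤ x (toℕ i)) (sym (toℕ-inject₁ j₀)) (≤-trans (n≤1+n _) j≤x))

  belowNeighbour : ∀ i j → toℕ j ≡ x (suc (toℕ i)) → toℕ i ≢ m → OneBelow A i j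
  belowNeighbour i j j≡x notLast = i' , i'≡ ,
    between⇒one i' j
      (subst (λ k → x (suc k) ≤ toℕ j) (sym i'≡) (subst (x (suc (suc (toℕ i))) ≤_) (sym j≡x) (x-step _)))
      (subst (λ k → toℕ j ≤ x k) (sym i'≡) (≤-reflexive j≡x))
    where
    i' = proj₁ (nextRow i notLast)
    i'≡ = proj₂ (nextRow i notLast)

  oneNeighbour : ∀ i j → A i j ≡ true → ¬ ((toℕ i ≡ m) × (toℕ j ≡ 0)) → OneLeft A i j ⊎ OneBelow A i j
  oneNeighbour i j a notCorner with x (suc (toℕ i)) <? toℕ j
  ... | yes x<j = inj₁ (leftNeighbour i j x<j (proj₂ (one⇒between i j a)))
  ... | no ¬x<j = inj₂ (belowNeighbour i j j≡x λ i≡m → notCorner (i≡m , trans j≡x (lastRow i i≡m)))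
    where
    j≡x : toℕ j ≡ x (suc (toℕ i))
    j≡x = ≤-antisym (≮⇒≥ ¬x<j) (proj₁ (one⇒between i j a))

  notBothNeighbours : ∀ i j → ¬ (OneLeft A i j × OneBelow A i j)
  notBothNeighbours i j ((j' , 1+j'≡j , left) , (i' , i'≡ , below)) = 1+n≰n (begin
    suc (toℕ j')        ≡⟨ 1+j'≡j ⟩
    toℕ j               ≤⟨ proj₂ (one⇒between i' j below) ⟩
    x (toℕ i')          ≡⟨ cong x i'≡ ⟩
    x (suc (toℕ i))     ≤⟨ proj₁ (one⇒between i j' left) ⟩
    toℕ j'              ∎)
    where open ≤-Reasoning

  -- The corners (0 , n) and (m , 0) are 1's since x 1 ≤ n = x 0 and x (m+1) = 0.
  zigzag : numOnes A ≡ suc m + suc n ∸ 1 → CompleteZigzag A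
  zigzag count≡ = count≡ ,
    (λ i j i≡0 j≡n → between⇒one i j
      (subst₂ (λ a b → x (suc a) ≤ b) (sym i≡0) (sym j≡n) (≤-trans (x-step 0) (≤-reflexive x-top)))
      (subst₂ (λ a b → b ≤ x a) (sym i≡0) (sym j≡n) (≤-reflexive (sym x-top)))) ,
    (λ i j i≡m j≡0 → between⇒one i j
      (subst₂ (λ a b → x (suc a) ≤ b) (sym i≡m) (sym j≡0) (≤-reflexive x-bottom))
      (subst (_≤ x (toℕ i)) (sym j≡0) z≤n)) ,
    λ i j a notCorner → oneNeighbour i j a notCorner , notBothNeighbours i j

-- The theorem (it holds as soon as m , n ≥ 1).
lemma2p2 : (m n : ℕ) → 2 ≤ m → 2 ≤ n → (A : Matrix m n) →
    Avoid12 A → numOnes A ≡ m + n ∸ 1 →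
    (Σ (Matrix m n) λ F → IsFerrers F × ShiftOf F A) × CompleteZigzag A
lemma2p2 (suc m) (suc n) (s≤s _) (s≤s _) A avoids maxOnes = (F , ferrers , shift) , zigzag maxOnes
  where
  extremal : numOnes A ≡ suc m + n
  extremal = trans maxOnes (+-∸-assoc (suc m) (s≤s z≤n))
  staircase : Staircase A n
  staircase = proj₂ (countBound (suc m) A avoids n (n<1+n n) (λ _ j _ → s≤s⁻¹ (toℕ<n j))) extremal
  open FromStaircase A staircase
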